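{- Let $(\mathcal{A}_1,\mathcal{D}_1)$ and $(\mathcal{A}_2,\mathcal{D}_2)$ be duality pairs of finite directed graphs. For $i=1,2$ let $\mathcal{A}_i'=\{A\in\mathcal{A}_i\mid \exists B\in\mathcal{A}_{3-i}: B\to A\}$ and $\mathcal{A}_i''=\mathcal{A}_i\setminus\mathcal{A}_i'$. Let $\mathcal{D}=\mathcal{D}_1\cup\mathcal{D}_2$. Then: (i) $(\mathcal{A},\mathcal{D})$ is a duality pair, where $\mathcal{A}=\{A_1\cup A_2\mid A_1\in\mathcal{A}_1, A_2\in\mathcal{A}_2\}$; (ii) $(\mathcal{A}',\mathcal{D})$ is a duality pair, where $\mathcal{A}'=\mathcal{A}_1'\cup\mathcal{A}_2'\cup\{A_1\cup A_2\mid A_1\in\mathcal{A}_1'', A_2\in\mathcal{A}_2''\}$; (iii) if both $\mathcal{A}_1$ and $\mathcal{A}_2$ are antichains and $|\mathcal{D}_1|=|\mathcal{D}_2|=1$, then $\mathcal{A}'$ becomes an antichain after removing duplicates, i.e. keeping only one member of each pair of equivalent graphs one from $\mathcal{A}_1$ and one from $\mathcal{A}_2$.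
   Context: A (finite directed) graph is a pair $(V,E)$ with $V$ finite, $E\subseteq V^2$. A homomorphism $G\to H$ is a map $V(G)\to V(H)$ sending edges to edges; $G\to H$ means one exists. Graphs $G,H$ are equivalent if $G\to H$ and $H\to G$. A family is an antichain if there is no homomorphism between any two distinct members. $A_1\cup A_2$ denotes the disjoint union of graphs $A_1$ and $A_2$. A duality pair is a pair $(\mathcal{A},\mathcal{D})$ of families of graphs such that for every graph $G$ exactly one holds: $A\to G$ for some $A\in\mathcal{A}$, or $G\to D$ for some $D\in\mathcal{D}$. -}

module Defs where

open import Data.Nat using (ℕ; _+_)
open import Data.Fin using (Fin; splitAt)
open import Data.Bool using (Bool; true; false)
open import Data.Vec using (Vec; lookup; tabulate)
open import Data.Sum using (_⊎_; inj₁; inj₂)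
open import Data.Product using (Σ; ∃; ∃-syntax; _×_; _,_)
open import Relation.Nullary using (¬_)
open import Relation.Binary.PropositionalEquality using (_≡_)

record Graph : Set where
  constructor graph
  field
    n   : ℕ
    adj : Vec (Vec Bool n) n

open Graph public

Edge : (G : Graph) → Fin (n G) → Fin (n G) → Set
Edge G x y = lookup (lookup (adj G) x) y ≡ true

record Hom (G H : Graph) : Set where
  constructor hom
  field
    f        : Fin (n G) → Fin (n H)
    preserve : ∀ x y → Edge G x y → Edge H (f x) (f y)

_⟶_ : Graph → Graph → Set
G ⟶ H = Hom G H

_⟷_ : Graph → Graph → Set
G ⟷ H = (G ⟶ H) × (H ⟶ G)

unionAdj : ∀ {n₁ n₂} → Vec (Vec Bool n₁) n₁ → Vec (Vec Bool n₂) n₂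
         → Fin (n₁ + n₂) → Fin (n₁ + n₂) → Bool
unionAdj {n₁} a₁ a₂ x y with splitAt n₁ x | splitAt n₁ y
... | inj₁ i | inj₁ j = lookup (lookup a₁ i) j
... | inj₂ i | inj₂ j = lookup (lookup a₂ i) j
... | inj₁ _ | inj₂ _ = false
... | inj₂ _ | inj₁ _ = false

_⊔ᴳ_ : Graph → Graph → Graph
G ⊔ᴳ H = graph (n G + n H)
  (tabulate (λ x → tabulate (λ y → unionAdj (adj G) (adj H) x y)))

Family : Set₁
Family = Graph → Set

DualityPair : Family → Family → Set
DualityPair 𝒜 𝒟 = ∀ G →
  let P = ∃[ A ] (𝒜 A × (A ⟶ G))
      Q = ∃[ D ] (𝒟 D × (G ⟶ D))
  in (P ⊎ Q) × ¬ (P × Q)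

Antichain : Family → Set
Antichain 𝒜 = ∀ A B → 𝒜 A → 𝒜 B → ¬ (A ≡ B) → ¬ (A ⟶ B)

HasOneMember : Family → Set
HasOneMember 𝒟 = ∃[ D ] (𝒟 D × (∀ D′ → 𝒟 D′ → D′ ≡ D))

_∪ᶠ_ : Family → Family → Family
(𝒜 ∪ᶠ ℬ) G = 𝒜 G ⊎ ℬ G

Unions : Family → Family → Family
Unions 𝒜₁ 𝒜₂ G = ∃[ A₁ ] ∃[ A₂ ] (𝒜₁ A₁ × 𝒜₂ A₂ × (G ≡ A₁ ⊔ᴳ A₂))

Prime : Family → Family → Family
Prime 𝒜 ℬ A = 𝒜 A × ∃[ B ] (ℬ B × (B ⟶ A))

DPrime : Family → Family → Family
DPrime 𝒜 ℬ A = 𝒜 A × ¬ (Prime 𝒜 ℬ A)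

APrime : Family → Family → Family
APrime 𝒜₁ 𝒜₂ = (Prime 𝒜₁ 𝒜₂ ∪ᶠ Prime 𝒜₂ 𝒜₁) ∪ᶠ Unions (DPrime 𝒜₁ 𝒜₂) (DPrime 𝒜₂ 𝒜₁)

-- "𝒜 becomes an antichain after removing duplicates (equivalent pairs, one
-- member from 𝒜₁ and one from 𝒜₂)": any homomorphism between two distinct
-- members of 𝒜 goes between equivalent graphs, one in 𝒜₁ and the other in 𝒜₂.
AntichainUpToDuplicates : Family → Family → Family → Set
AntichainUpToDuplicates 𝒜₁ 𝒜₂ 𝒜 = ∀ X Y → 𝒜 X → 𝒜 Y → ¬ (X ≡ Y) → X ⟶ Y →
  (X ⟷ Y) × ((𝒜₁ X × 𝒜₂ Y) ⊎ (𝒜₂ X × 𝒜₁ Y))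

-- A graph maps to no member of 𝒟₁ ∪ 𝒟₂ exactly when it is above a member of
-- 𝒜₁ and above a member of 𝒜₂.  So 𝒜 is an obstruction set for 𝒟₁ ∪ 𝒟₂ as
-- soon as each of its members is above a member of both 𝒜ᵢ and each graph
-- above a member of both 𝒜ᵢ is above a member of 𝒜; this gives (i) and (ii).
-- For (iii) the key fact is: if X ∈ 𝒜 maps to Y₁ ⊔ Y₂ where Y₂ maps to every
-- dual, then X restricted to the edges sent into Y₁ cannot map to a dual
-- (gluing with Y₂ → D would map X there), so it is above some A ∈ 𝒜, and
-- A → X, A → Y₁; in an antichain this forces X = Y₁.
module Submission where

open import Defs
open import Data.Nat using (zero; suc)
open import Data.Fin as Fin using (Fin; splitAt; _↑ˡ_; _↑ʳ_)
open import Data.Fin.Properties using (splitAt-↑ˡ; splitAt-↑ʳ)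
open import Data.Bool using (Bool; true; false)
import Data.Bool.Properties as Bool
open import Data.Vec using (lookup; tabulate)
open import Data.Vec.Properties using (lookup∘tabulate; ≡-dec)
open import Data.Sum using (_⊎_; inj₁; inj₂; [_,_])
open import Data.Sum.Relation.Binary.Pointwise using (Pointwise; inj₁; inj₂)
open import Data.Product using (∃-syntax; _×_; _,_; proj₁; proj₂)
open import Data.Empty using (⊥-elim)
open import Function using (id; const; _∘_)
open import Relation.Nullary using (¬_; Dec; yes; no)
open import Relation.Nullary.Decidable using (decidable-stable)
open import Relation.Binary.PropositionalEquality
  using (_≡_; refl; sym; trans; cong; cong₂; subst)
import Data.Nat.Properties as ℕ

private
  variable
    G H K X Y₁ Y₂ : Graph
    𝒜 𝒜₁ 𝒜₂ 𝒟 𝒟₁ 𝒟₂ : Family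

⟶-refl : G ⟶ G
⟶-refl = hom id (λ _ _ e → e)

⟶-trans : G ⟶ H → H ⟶ K → G ⟶ K
⟶-trans (hom f pf) (hom g pg) = hom (g ∘ f) (λ x y e → pg (f x) (f y) (pf x y e))

_≟ᴳ_ : (G H : Graph) → Dec (G ≡ H)
graph m a ≟ᴳ graph n b with m ℕ.≟ n
... | no m≢n = no (λ G≡H → m≢n (cong Graph.n G≡H))
... | yes refl with ≡-dec (≡-dec Bool._≟_) a b
...   | yes refl = yes refl
...   | no a≢b   = no (λ { refl → a≢b refl })

graphOf : ∀ {m} → (Fin m → Fin m → Bool) → Graph
graphOf {m} r = graph m (tabulate (λ x → tabulate (r x)))

lookup-graphOf : ∀ {m} (r : Fin m → Fin m → Bool) x y →
                 lookup (lookup (adj (graphOf r)) x) y ≡ r x y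
lookup-graphOf r x y rewrite lookup∘tabulate (λ x → tabulate (r x)) x =
  lookup∘tabulate (r x) y

Edge-graphOf⁻ : ∀ {m} (r : Fin m → Fin m → Bool) {x y} → Edge (graphOf r) x y → r x y ≡ true
Edge-graphOf⁻ r {x} {y} = trans (sym (lookup-graphOf r x y))

Edge-graphOf⁺ : ∀ {m} (r : Fin m → Fin m → Bool) {x y} → r x y ≡ true → Edge (graphOf r) x y
Edge-graphOf⁺ r {x} {y} = trans (lookup-graphOf r x y)

Edge-⊔ᴳ : ∀ {x y} → Edge (G ⊔ᴳ H) x y →
          Pointwise (Edge G) (Edge H) (splitAt (n G) x) (splitAt (n G) y)
Edge-⊔ᴳ {G} {H} {x} {y} e with splitAt (n G) x | splitAt (n G) y
                             | Edge-graphOf⁻ (unionAdj (adj G) (adj H)) e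
... | inj₁ _ | inj₁ _ | e′ = inj₁ e′
... | inj₂ _ | inj₂ _ | e′ = inj₂ e′
... | inj₁ _ | inj₂ _ | ()
... | inj₂ _ | inj₁ _ | ()

inj₁-⟶ : ∀ {G H} → G ⟶ (G ⊔ᴳ H)
inj₁-⟶ {G} {H} = hom (_↑ˡ n H) (λ i j e → Edge-graphOf⁺ (unionAdj (adj G) (adj H)) (left i j e))
  where
  left : ∀ i j → Edge G i j → unionAdj (adj G) (adj H) (i ↑ˡ n H) (j ↑ˡ n H) ≡ true
  left i j e rewrite splitAt-↑ˡ (n G) i (n H) | splitAt-↑ˡ (n G) j (n H) = e

inj₂-⟶ : ∀ {G H} → H ⟶ (G ⊔ᴳ H)
inj₂-⟶ {G} {H} = hom (n G ↑ʳ_) (λ i j e → Edge-graphOf⁺ (unionAdj (adj G) (adj H)) (right i j e))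
  where
  right : ∀ i j → Edge H i j → unionAdj (adj G) (adj H) (n G ↑ʳ i) (n G ↑ʳ j) ≡ true
  right i j e rewrite splitAt-↑ʳ (n G) (n H) i | splitAt-↑ʳ (n G) (n H) j = e

[_,_]⟶ : ∀ {G H K} → G ⟶ K → H ⟶ K → (G ⊔ᴳ H) ⟶ K
[_,_]⟶ {G} {H} {K} (hom f pf) (hom g pg) =
  hom (λ x → [ f , g ] (splitAt (n G) x)) (λ x y e → along (Edge-⊔ᴳ e))
  where
  along : ∀ {a b} → Pointwise (Edge G) _ a b → Edge K ([ f , g ] a) ([ f , g ] b)
  along (inj₁ e) = pf _ _ e
  along (inj₂ e) = pg _ _ e

⊔ᴳ-swap : ∀ {G H} → (G ⊔ᴳ H) ⟶ (H ⊔ᴳ G)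
⊔ᴳ-swap {G} {H} = [ inj₂-⟶ {H} {G} , inj₁-⟶ {H} {G} ]⟶

-- The part of X sent into Y₁ by h, as a graph on all vertices of X that keeps
-- only the edges leaving vertices sent into Y₁.
module LeftPart {X Y₁ Y₂ : Graph} (h : X ⟶ (Y₁ ⊔ᴳ Y₂)) where

  side : Fin (n X) → Fin (n Y₁) ⊎ Fin (n Y₂)
  side v = splitAt (n Y₁) (Hom.f h v)

  side-edge : ∀ {v w} → Edge X v w → Pointwise (Edge Y₁) (Edge Y₂) (side v) (side w)
  side-edge {v} {w} e = Edge-⊔ᴳ (Hom.preserve h v w e)

  leftAdj : Fin (n X) → Fin (n X) → Bool
  leftAdj v w with side v
  ... | inj₁ _ = lookup (lookup (adj X) v) w
  ... | inj₂ _ = false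

  left : Graph
  left = graphOf leftAdj

  Edge-left⁻ : ∀ {v w} → Edge left v w → Edge X v w
  Edge-left⁻ {v} {w} e with side v | Edge-graphOf⁻ leftAdj e
  ... | inj₁ _ | e′ = e′

  Edge-left⁺ : ∀ {v w i} → side v ≡ inj₁ i → Edge X v w → Edge left v w
  Edge-left⁺ {v} {w} eq e = Edge-graphOf⁺ leftAdj (toLeftAdj eq)
    where
    toLeftAdj : ∀ {i} → side v ≡ inj₁ i → leftAdj v w ≡ true
    toLeftAdj eq rewrite eq = e

  left⟶X : left ⟶ X
  left⟶X = hom id (λ _ _ → Edge-left⁻)

  left⟶Y₁ : Fin (n Y₁) → left ⟶ Y₁
  left⟶Y₁ y₀ = hom (λ v → [ id , const y₀ ] (side v)) preserve
    where
    preserve : ∀ v w → Edge left v w →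
               Edge Y₁ ([ id , const y₀ ] (side v)) ([ id , const y₀ ] (side w))
    preserve v w e with side v | side w | side-edge (Edge-left⁻ e) | Edge-graphOf⁻ leftAdj e
    ... | inj₁ _ | inj₁ _ | inj₁ e′ | _  = e′
    ... | inj₂ _ | inj₂ _ | inj₂ _  | ()

  glue : ∀ {D} → left ⟶ D → Y₂ ⟶ D → X ⟶ D
  glue {D} g k = hom F preserve
    where
    F : Fin (n X) → Fin (n D)
    F v = [ const (Hom.f g v) , Hom.f k ] (side v)

    preserve : ∀ v w → Edge X v w → Edge D (F v) (F w)
    preserve v w e with side v in eq | side w | side-edge e
    ... | inj₁ _ | inj₁ _ | inj₁ _  = Hom.preserve g v w (Edge-left⁺ eq e)
    ... | inj₂ _ | inj₂ _ | inj₂ e′ = Hom.preserve k _ _ e′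

Covers : Family → Graph → Set
Covers 𝒜 G = ∃[ A ] (𝒜 A × (A ⟶ G))

Below : Graph → Family → Set
Below G 𝒟 = ∃[ D ] (𝒟 D × (G ⟶ D))

Covers-⟶ : Covers 𝒜 G → G ⟶ H → Covers 𝒜 H
Covers-⟶ (A , a , f) g = A , a , ⟶-trans f g

covers? : DualityPair 𝒜 𝒟 → ∀ G → Dec (Covers 𝒜 G)
covers? dp G with proj₁ (dp G)
... | inj₁ c = yes c
... | inj₂ b = no (λ c → proj₂ (dp G) (c , b))

uncovered⇒Below : DualityPair 𝒜 𝒟 → ¬ Covers 𝒜 G → Below G 𝒟
uncovered⇒Below {G = G} dp ¬c = [ ⊥-elim ∘ ¬c , id ] (proj₁ (dp G))

Below-unique : HasOneMember 𝒟 → Below G 𝒟 → ∀ {D} → 𝒟 D → G ⟶ D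
Below-unique (_ , _ , unique) (D′ , d′ , g) {D} d
  rewrite unique D′ d′ | unique D d = g

antichain-⟶⇒≡ : Antichain 𝒜 → 𝒜 G → 𝒜 H → G ⟶ H → G ≡ H
antichain-⟶⇒≡ {G = G} {H} ac g h f = decidable-stable (G ≟ᴳ H) (λ G≢H → ac G H g h G≢H f)

summand-obstruction : DualityPair 𝒜 𝒟 → 𝒜 X → Fin (n Y₁) → (∀ {D} → 𝒟 D → Y₂ ⟶ D) →
                      X ⟶ (Y₁ ⊔ᴳ Y₂) → ∃[ A ] (𝒜 A × (A ⟶ X) × (A ⟶ Y₁))
summand-obstruction {X = X} {Y₁} {Y₂} dp x y₀ Y₂⟶𝒟 h =
  [ (λ (A , a , f) → A , a , ⟶-trans f left⟶X , ⟶-trans f (left⟶Y₁ y₀))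
  , (λ (D , d , g) → ⊥-elim (proj₂ (dp X) ((X , x , ⟶-refl) , D , d , glue g (Y₂⟶𝒟 d))))
  ] (proj₁ (dp left))
  where open LeftPart {X} {Y₁} {Y₂} h

antichain-summand : DualityPair 𝒜 𝒟 → Antichain 𝒜 → 𝒜 X → 𝒜 Y₁ →
                    (∀ {D} → 𝒟 D → Y₂ ⟶ D) → X ⟶ (Y₁ ⊔ᴳ Y₂) → X ≡ Y₁
antichain-summand {Y₁ = graph zero _} _ ac x y _ _ =
  sym (antichain-⟶⇒≡ ac y x (hom (λ ()) (λ ())))
antichain-summand {Y₁ = graph (suc _) _} dp ac x y Y₂⟶𝒟 h
  with summand-obstruction dp x Fin.zero Y₂⟶𝒟 h
... | A , a , A⟶X , A⟶Y₁ =
  trans (sym (antichain-⟶⇒≡ ac a x A⟶X)) (antichain-⟶⇒≡ ac a y A⟶Y₁)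

dualityPair-∪ : DualityPair 𝒜₁ 𝒟₁ → DualityPair 𝒜₂ 𝒟₂ →
                (∀ {G} → Covers 𝒜₁ G → Covers 𝒜₂ G → Covers 𝒜 G) →
                (∀ {X} → 𝒜 X → Covers 𝒜₁ X × Covers 𝒜₂ X) →
                DualityPair 𝒜 (𝒟₁ ∪ᶠ 𝒟₂)
dualityPair-∪ {𝒜₁} {𝒟₁} {𝒜₂} {𝒟₂} {𝒜} dp₁ dp₂ meet above G = exists , exclusive
  where
  exists : Covers 𝒜 G ⊎ Below G (𝒟₁ ∪ᶠ 𝒟₂)
  exists with proj₁ (dp₁ G) | proj₁ (dp₂ G)
  ... | inj₁ c₁          | inj₁ c₂          = inj₁ (meet c₁ c₂)
  ... | inj₂ (D , d , g) | _                = inj₂ (D , inj₁ d , g)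
  ... | inj₁ _           | inj₂ (D , d , g) = inj₂ (D , inj₂ d , g)

  exclusive : ¬ (Covers 𝒜 G × Below G (𝒟₁ ∪ᶠ 𝒟₂))
  exclusive ((X , x , f) , D , inj₁ d , g) =
    proj₂ (dp₁ G) (Covers-⟶ (proj₁ (above x)) f , D , d , g)
  exclusive ((X , x , f) , D , inj₂ d , g) =
    proj₂ (dp₂ G) (Covers-⟶ (proj₂ (above x)) f , D , d , g)

unions-dualityPair : DualityPair 𝒜₁ 𝒟₁ → DualityPair 𝒜₂ 𝒟₂ →
                     DualityPair (Unions 𝒜₁ 𝒜₂) (𝒟₁ ∪ᶠ 𝒟₂)
unions-dualityPair dp₁ dp₂ = dualityPair-∪ dp₁ dp₂ meet above
  where
  meet : Covers _ G → Covers _ G → Covers (Unions _ _) G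
  meet (A₁ , a₁ , f₁) (A₂ , a₂ , f₂) = A₁ ⊔ᴳ A₂ , (A₁ , A₂ , a₁ , a₂ , refl) , [ f₁ , f₂ ]⟶

  above : Unions 𝒜₁ 𝒜₂ X → Covers 𝒜₁ X × Covers 𝒜₂ X
  above (A₁ , A₂ , a₁ , a₂ , refl) = (A₁ , a₁ , inj₁-⟶) , (A₂ , a₂ , inj₂-⟶)

aPrime-dualityPair : DualityPair 𝒜₁ 𝒟₁ → DualityPair 𝒜₂ 𝒟₂ →
                     DualityPair (APrime 𝒜₁ 𝒜₂) (𝒟₁ ∪ᶠ 𝒟₂)
aPrime-dualityPair {𝒜₁} {𝒟₁} {𝒜₂} dp₁ dp₂ = dualityPair-∪ dp₁ dp₂ meet above
  where
  meet : Covers 𝒜₁ G → Covers 𝒜₂ G → Covers (APrime 𝒜₁ 𝒜₂) G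
  meet (A₁ , a₁ , f₁) (A₂ , a₂ , f₂) with covers? dp₂ A₁ | covers? dp₁ A₂
  ... | yes c₁ | _      = A₁ , inj₁ (inj₁ (a₁ , c₁)) , f₁
  ... | no _   | yes c₂ = A₂ , inj₁ (inj₂ (a₂ , c₂)) , f₂
  ... | no ¬c₁ | no ¬c₂ =
    A₁ ⊔ᴳ A₂ , inj₂ (A₁ , A₂ , (a₁ , ¬c₁ ∘ proj₂) , (a₂ , ¬c₂ ∘ proj₂) , refl) , [ f₁ , f₂ ]⟶

  above : APrime 𝒜₁ 𝒜₂ X → Covers 𝒜₁ X × Covers 𝒜₂ X
  above {X} (inj₁ (inj₁ (a , c))) = (X , a , ⟶-refl) , c
  above {X} (inj₁ (inj₂ (a , c))) = c , (X , a , ⟶-refl)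
  above (inj₂ (A₁ , A₂ , (a₁ , _) , (a₂ , _) , refl)) = (A₁ , a₁ , inj₁-⟶) , (A₂ , a₂ , inj₂-⟶)

aPrime-antichain : DualityPair 𝒜₁ 𝒟₁ → DualityPair 𝒜₂ 𝒟₂ →
                   Antichain 𝒜₁ → Antichain 𝒜₂ → HasOneMember 𝒟₁ → HasOneMember 𝒟₂ →
                   AntichainUpToDuplicates 𝒜₁ 𝒜₂ (APrime 𝒜₁ 𝒜₂)
aPrime-antichain {𝒜₁} {𝒟₁} {𝒜₂} {𝒟₂} dp₁ dp₂ ac₁ ac₂ one₁ one₂ _ _ = go
  where
  below₁ : ∀ {Z} → DPrime 𝒜₂ 𝒜₁ Z → ∀ {D} → 𝒟₁ D → Z ⟶ D
  below₁ (a , ¬p) = Below-unique one₁ (uncovered⇒Below dp₁ (λ c → ¬p (a , c)))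

  below₂ : ∀ {Z} → DPrime 𝒜₁ 𝒜₂ Z → ∀ {D} → 𝒟₂ D → Z ⟶ D
  below₂ (a , ¬p) = Below-unique one₂ (uncovered⇒Below dp₂ (λ c → ¬p (a , c)))

  go : ∀ {X Y} → APrime 𝒜₁ 𝒜₂ X → APrime 𝒜₁ 𝒜₂ Y → ¬ (X ≡ Y) → X ⟶ Y →
       (X ⟷ Y) × ((𝒜₁ X × 𝒜₂ Y) ⊎ (𝒜₂ X × 𝒜₁ Y))
  go {X} {Y} (inj₁ (inj₁ (x , _))) (inj₁ (inj₁ (y , _))) X≢Y h = ⊥-elim (ac₁ X Y x y X≢Y h)
  go {X} {Y} (inj₁ (inj₂ (x , _))) (inj₁ (inj₂ (y , _))) X≢Y h = ⊥-elim (ac₂ X Y x y X≢Y h)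
  go {X} (inj₁ (inj₁ (x , C , c , C⟶X))) (inj₁ (inj₂ (y , _))) _ h =
    (h , subst (_⟶ X) (antichain-⟶⇒≡ ac₂ c y (⟶-trans C⟶X h)) C⟶X) , inj₁ (x , y)
  go {X} (inj₁ (inj₂ (x , C , c , C⟶X))) (inj₁ (inj₁ (y , _))) _ h =
    (h , subst (_⟶ X) (antichain-⟶⇒≡ ac₁ c y (⟶-trans C⟶X h)) C⟶X) , inj₂ (x , y)
  go (inj₁ (inj₁ pX)) (inj₂ (Y₁ , Y₂ , (y₁ , ¬pY₁) , pY₂ , refl)) _ h =
    ⊥-elim (¬pY₁ (subst (Prime 𝒜₁ 𝒜₂) (antichain-summand dp₁ ac₁ (proj₁ pX) y₁ (below₁ pY₂) h) pX))
  go (inj₁ (inj₂ pX)) (inj₂ (Y₁ , Y₂ , pY₁ , (y₂ , ¬pY₂) , refl)) _ h =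
    ⊥-elim (¬pY₂ (subst (Prime 𝒜₂ 𝒜₁)
      (antichain-summand dp₂ ac₂ (proj₁ pX) y₂ (below₂ pY₁) (⟶-trans h (⊔ᴳ-swap {Y₁} {Y₂}))) pX))
  go (inj₂ (X₁ , X₂ , (x₁ , ¬pX₁) , _ , refl)) (inj₁ (inj₁ pY)) _ h =
    ⊥-elim (¬pX₁ (subst (Prime 𝒜₁ 𝒜₂) (sym (antichain-⟶⇒≡ ac₁ x₁ (proj₁ pY) (⟶-trans inj₁-⟶ h))) pY))
  go (inj₂ (X₁ , X₂ , _ , (x₂ , ¬pX₂) , refl)) (inj₁ (inj₂ pY)) _ h =
    ⊥-elim (¬pX₂ (subst (Prime 𝒜₂ 𝒜₁) (sym (antichain-⟶⇒≡ ac₂ x₂ (proj₁ pY) (⟶-trans inj₂-⟶ h))) pY))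
  go (inj₂ (X₁ , X₂ , (x₁ , _) , (x₂ , _) , refl)) (inj₂ (Y₁ , Y₂ , pY₁ , pY₂ , refl)) X≢Y h =
    ⊥-elim (X≢Y (cong₂ _⊔ᴳ_
      (antichain-summand dp₁ ac₁ x₁ (proj₁ pY₁) (below₁ pY₂) (⟶-trans inj₁-⟶ h))
      (antichain-summand dp₂ ac₂ x₂ (proj₁ pY₂) (below₂ pY₁) (⟶-trans inj₂-⟶ (⟶-trans h (⊔ᴳ-swap {Y₁} {Y₂}))))))

lemma14 : (𝒜₁ 𝒟₁ 𝒜₂ 𝒟₂ : Family) → DualityPair 𝒜₁ 𝒟₁ → DualityPair 𝒜₂ 𝒟₂ →
    DualityPair (Unions 𝒜₁ 𝒜₂) (𝒟₁ ∪ᶠ 𝒟₂)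
    × DualityPair (APrime 𝒜₁ 𝒜₂) (𝒟₁ ∪ᶠ 𝒟₂)
    × (Antichain 𝒜₁ → Antichain 𝒜₂ → HasOneMember 𝒟₁ → HasOneMember 𝒟₂ →
       AntichainUpToDuplicates 𝒜₁ 𝒜₂ (APrime 𝒜₁ 𝒜₂))
lemma14 _ _ _ _ dp₁ dp₂ =
  unions-dualityPair dp₁ dp₂ , aPrime-dualityPair dp₁ dp₂ , aPrime-antichain dp₁ dp₂
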